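{- Let $\mathsf M$ be a loopless matroid on $[n]$ and $\Bbbk$ a field, and let $\pi$ be the partition of $[n]$ into the equivalence classes of the relation $i\sim j\iff (i=j$ or $\{i,j\}$ is dependent in $\mathsf M)$. Then $\mathcal R^0_1(\mathsf M)=P_\pi$.
   Context: Let $V=\Bbbk^n$ with basis $e_1,\dots,e_n$, $E=\Lambda(V)$, $\partial$ the graded derivation with $\partial(e_i)=1$, $e_C=\prod_{i\in C}e_i$. $A(\mathsf M)=E/I$ with $I$ the ideal generated by $\partial(e_C)$ for circuits $C$ of $\mathsf M$. For $v\in V$ let $(A(\mathsf M),\cdot v)$ be the cochain complex with differential $x\mapsto xv$, and $\mathcal R^p_d(\mathsf M)=\{v\in V:\dim_\Bbbk H^p(A(\mathsf M),\cdot v)\ge d\}$. For a partition $\pi=\{\pi_1,\dots,\pi_k\}$ of $[n]$, $P_\pi=\{x\in\Bbbk^n:\sum_{j\in\pi_i}x_j=0\ \text{for } 1\le i\le k\}$. -}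

module Defs where

open import Level using (Level; _⊔_)
open import Data.Nat as ℕ using (ℕ; zero; suc)
open import Data.Bool using (Bool; true; false; not; _∧_; _∨_; if_then_else_)
open import Data.Fin as Fin using (Fin; zero; suc)
open import Data.Vec using (Vec; []; _∷_)
open import Data.Vec.Properties using (≡-dec)
open import Data.Bool.Properties using () renaming (_≟_ to _≟ᵇ_)
open import Data.Fin.Subset using (Subset; inside; outside; ⁅_⁆; _∪_; _∩_; ∁; _∈_; _∉_; _⊆_; _⊂_; ∣_∣)
open import Data.Product using (Σ; ∃; _×_; _,_)
open import Relation.Nullary using (¬_; does)
open import Relation.Binary.PropositionalEquality using (_≡_)
open import Algebra.Bundles using (CommutativeRing)

record Field (c ℓ : Level) : Set (Level.suc (c ⊔ ℓ)) where
  field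
    commutativeRing : CommutativeRing c ℓ
  open CommutativeRing commutativeRing public
  field
    0≉1 : ¬ (0# ≈ 1#)
    inverse : ∀ x → ¬ (x ≈ 0#) → ∃ λ y → x * y ≈ 1#

record Matroid (n : ℕ) : Set where
  field
    indep : Subset n → Bool

  Independent : Subset n → Set
  Independent S = indep S ≡ true

  Dependent : Subset n → Set
  Dependent S = indep S ≡ false

  Circuit : Subset n → Set
  Circuit C = Dependent C × (∀ D → D ⊂ C → Independent D)

  field
    indep-⊥ : Independent (Data.Fin.Subset.⊥)
    indep-⊆ : ∀ {I J} → Independent J → I ⊆ J → Independent I
    indep-exchange : ∀ {I J} → Independent I → Independent J → ∣ I ∣ ℕ.< ∣ J ∣ →
                     ∃ λ x → x ∈ J × x ∉ I × Independent (I ∪ ⁅ x ⁆)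

Loopless : ∀ {n} → Matroid n → Set
Loopless {n} M = ∀ (i : Fin n) → Matroid.Independent M ⁅ i ⁆

_==ˢ_ : ∀ {n} → Subset n → Subset n → Bool
S ==ˢ T = does (≡-dec _≟ᵇ_ S T)

_∈ᵇ_ : ∀ {n} → Fin n → Subset n → Bool
zero  ∈ᵇ (x ∷ S) = x
suc i ∈ᵇ (x ∷ S) = i ∈ᵇ S

_⊆ᵇ_ : ∀ {n} → Subset n → Subset n → Bool
[]      ⊆ᵇ []      = true
(x ∷ S) ⊆ᵇ (y ∷ T) = (not x ∨ y) ∧ (S ⊆ᵇ T)

-- number of pairs (t , u) with t ∈ T, u ∈ U, u < t
inversions : ∀ {n} → Subset n → Subset n → ℕ
inversions []      []      = 0
inversions (t ∷ T) (u ∷ U) = (if u then ∣ T ∣ else 0) ℕ.+ inversions T U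

below : ∀ {n} → Subset n → Fin n → ℕ
below (x ∷ C) zero    = 0
below (x ∷ C) (suc i) = (if x then 1 else 0) ℕ.+ below C i

module OverField {c ℓ} (K : Field c ℓ) where
  open Field K using (_≈_; _+_; _*_; -_; _-_; 0#; 1#) renaming (Carrier to k)

  negPow : ℕ → k → k
  negPow zero    x = x
  negPow (suc m) x = - negPow m x

  sumFin : ∀ {n} → (Fin n → k) → k
  sumFin {zero}  f = 0#
  sumFin {suc n} f = f zero + sumFin (λ i → f (suc i))

  sumSub : ∀ {n} → (Subset n → k) → k
  sumSub {zero}  f = f []
  sumSub {suc n} f = sumSub (λ T → f (outside ∷ T)) + sumSub (λ T → f (inside ∷ T))

  Vect : ℕ → Set c
  Vect n = Fin n → k

  -- the exterior algebra E = Λ(k^n): an element is its coefficient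
  -- family on the monomial basis e_S (S ⊆ [n], factors in increasing order)
  Ext : ℕ → Set c
  Ext n = Subset n → k

  _≈ᴱ_ : ∀ {n} → Ext n → Ext n → Set ℓ
  a ≈ᴱ b = ∀ S → a S ≈ b S

  0ᴱ : ∀ {n} → Ext n
  0ᴱ S = 0#

  _+ᴱ_ : ∀ {n} → Ext n → Ext n → Ext n
  (a +ᴱ b) S = a S + b S

  _-ᴱ_ : ∀ {n} → Ext n → Ext n → Ext n
  (a -ᴱ b) S = a S - b S

  _·ᴱ_ : ∀ {n} → k → Ext n → Ext n
  (x ·ᴱ a) S = x * a S

  -- wedge product: e_T ∧ e_U = (-1)^{inv(T,U)} e_{T ∪ U} if T ∩ U = ∅, else 0
  _∧ᴱ_ : ∀ {n} → Ext n → Ext n → Ext n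
  (a ∧ᴱ b) S = sumSub (λ T →
    if T ⊆ᵇ S then negPow (inversions T (S ∩ ∁ T)) (a T * b (S ∩ ∁ T)) else 0#)

  sumᴱ : ∀ {n m} → (Fin m → Ext n) → Ext n
  sumᴱ f S = sumFin (λ i → f i S)

  Homog : ∀ {n} → ℕ → Ext n → Set ℓ
  Homog p a = ∀ S → ¬ (∣ S ∣ ≡ p) → a S ≈ 0#

  ι : ∀ {n} → Vect n → Ext n
  ι v S = sumFin (λ i → if S ==ˢ ⁅ i ⁆ then v i else 0#)

  -- ∂(e_C) for the graded derivation with ∂(e_i) = 1:
  -- ∂(e_{i_1} ⋯ e_{i_p}) = Σ_j (-1)^{j-1} e_{i_1} ⋯ ê_{i_j} ⋯ e_{i_p}
  ∂e : ∀ {n} → Subset n → Ext n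
  ∂e C T = sumFin (λ i →
    if (i ∈ᵇ C) ∧ (T ==ˢ (C ∩ ∁ ⁅ i ⁆)) then negPow (below C i) 1# else 0#)

  module _ {n : ℕ} (M : Matroid n) where
    open Matroid M

    -- the ideal I ⊆ E generated by ∂(e_C), C a circuit of M
    -- (finite sums Σ a_j ∧ ∂(e_{C_j}); left = two-sided since generators are homogeneous)
    InI : Ext n → Set (c ⊔ ℓ)
    InI x = Σ ℕ λ m → Σ (Fin m → Ext n) λ a → Σ (Fin m → Subset n) λ C →
              (∀ j → Circuit (C j)) × (x ≈ᴱ sumᴱ (λ j → a j ∧ᴱ ∂e (C j)))

    -- cocycles and coboundaries of degree p of (A(M), · v), A(M) = E / I,
    -- represented by elements of E
    Cocycle : Vect n → ℕ → Ext n → Set (c ⊔ ℓ)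
    Cocycle v p x = Homog p x × InI (x ∧ᴱ ι v)

    Coboundary : Vect n → ℕ → Ext n → Set (c ⊔ ℓ)
    Coboundary v zero    x = InI x
    Coboundary v (suc p) x = Σ (Ext n) λ y → Homog p y × InI (x -ᴱ (y ∧ᴱ ι v))

    -- dim_k H^p(A(M), · v) ≥ d : there are d cocycles of degree p that are
    -- linearly independent modulo coboundaries
    DimH≥ : Vect n → ℕ → ℕ → Set (c ⊔ ℓ)
    DimH≥ v p d = Σ (Fin d → Ext n) λ x → (∀ j → Cocycle v p (x j)) ×
                  (∀ (γ : Fin d → k) → Coboundary v p (sumᴱ (λ j → γ j ·ᴱ x j)) → ∀ j → γ j ≈ 0#)

    Resonance : ℕ → ℕ → Vect n → Set (c ⊔ ℓ)
    Resonance p d v = DimH≥ v p d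

    related : Fin n → Fin n → Bool
    related i j = does (i Fin.≟ j) ∨ not (indep (⁅ i ⁆ ∪ ⁅ j ⁆))

    -- P_π for π the partition into ∼-classes: for every block (the class of
    -- some i), the sum of the coordinates over the block vanishes
    Pπ : Vect n → Set ℓ
    Pπ x = ∀ (i : Fin n) → sumFin (λ j → if related i j then x j else 0#) ≈ 0#

-- Degree-0 elements are scalars and I has no degree-0 component, so H^0 ≠ 0 exactly when
-- x·v ∈ I for some nonzero scalar x. A generator ∂(e_C) has no constant term, and its linear
-- part vanishes unless C = {p, q} is a circuit, where it is ±(e_q − e_p) with p ∼ q. Hence
-- the block sums Σ_{j ∼ i} (coefficient of e_j) vanish on I, giving v ∈ P_π. Conversely,
-- if v ∈ P_π and r(j) is a chosen element of the class of j, then v = Σ_j v_j (e_j − e_{r(j)}),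
-- since the coefficient collected on each e_k is a block sum; and each e_j − e_{r(j)} is 0
-- or ±∂(e_{r(j)} e_j), so v ∈ I.

module Submission where

open import Data.Bool using (Bool; true; false; _∧_; if_then_else_)
open import Data.Bool.Properties using (∨-zeroʳ; ⇔→≡) renaming (_≟_ to _≟ᵇ_)
open import Data.Empty using (⊥-elim)
open import Data.Fin using (Fin; zero; suc; _≟_)
open import Data.Fin.Properties using (any?; suc-injective)
open import Data.Fin.Subset using (Subset; ⁅_⁆; _∪_; _∩_; ∁; _∈_; _∉_; _⊆_; _⊂_; ∣_∣; ⊥; inside; outside)
open import Data.Fin.Subset.Properties
  using (x∈⁅x⁆; x∈⁅y⁆⇒x≡y; x∈p∪q⁻; x∈p∪q⁺; x∈p∩q⁺; x∈p∩q⁻; x∈p⇒x∉∁p; x∉p⇒x∈∁p;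
         ⊆-antisym; ⊆-reflexive;
         ∪-comm; ∪-identityˡ; ∪-identityʳ; ∩-zeroˡ; ∩-inverseʳ; ∣⁅x⁆∣≡1; ∣⊥∣≡0)
open import Data.Maybe as Maybe using (Maybe; just; nothing; fromMaybe)
open import Data.Nat as ℕ using (ℕ; zero; suc; s≤s; z≤n)
import Data.Nat.Properties as ℕ
open import Data.Product using (∃; _×_; _,_; proj₁; proj₂)
open import Data.Sum using (_⊎_; inj₁; inj₂)
open import Data.Vec using ([]; _∷_; here; there; tail)
open import Data.Vec.Functional using () renaming (_∷_ to _◂_)
open import Data.Vec.Properties using (≡-dec)
open import Function using (mk⇔)
open import Relation.Nullary using (¬_; does; yes; no; Dec)
open import Relation.Nullary.Decidable using (dec-true; dec-false; ¬?; _×-dec_)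
open import Relation.Nullary.Negation using (contradiction)
open import Relation.Binary.PropositionalEquality as ≡ using (_≡_; _≢_; refl; cong; subst; subst₂)
import Algebra.Properties.Ring as RingProperties
import Algebra.Properties.Semiring.Sum as SemiringSum
import Relation.Binary.Reasoning.Setoid as SetoidReasoning

open import Defs

private variable
  n : ℕ
  i j p q : Fin n
  S T C : Subset n

==ˢ⇒≡ : S ==ˢ T ≡ true → S ≡ T
==ˢ⇒≡ {S = S} {T} e with ≡-dec _≟ᵇ_ S T
... | yes S≡T = S≡T

==ˢ-refl : ∀ (S : Subset n) → S ==ˢ S ≡ true
==ˢ-refl S = dec-true (≡-dec _≟ᵇ_ S S) refl

≢⇒==ˢ-false : S ≢ T → S ==ˢ T ≡ false
≢⇒==ˢ-false {S = S} {T} = dec-false (≡-dec _≟ᵇ_ S T)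

⁅⁆-injective : ⁅ p ⁆ ≡ ⁅ q ⁆ → p ≡ q
⁅⁆-injective {p = p} {q} e = x∈⁅y⁆⇒x≡y q (subst (p ∈_) e (x∈⁅x⁆ p))

∈ᵇ⇒∈ : i ∈ᵇ C ≡ true → i ∈ C
∈ᵇ⇒∈ {i = zero} {true ∷ C} e = here
∈ᵇ⇒∈ {i = suc i} {_ ∷ C} e = there (∈ᵇ⇒∈ e)

∈⇒∈ᵇ : i ∈ C → i ∈ᵇ C ≡ true
∈⇒∈ᵇ here = refl
∈⇒∈ᵇ (there i∈C) = ∈⇒∈ᵇ i∈C

∉⇒∈ᵇ-false : i ∉ C → i ∈ᵇ C ≡ false
∉⇒∈ᵇ-false {i = i} {C} i∉C with i ∈ᵇ C in e
... | true = ⊥-elim (i∉C (∈ᵇ⇒∈ e))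
... | false = refl

∣∣≡0⇒≡⊥ : ∣ S ∣ ≡ 0 → S ≡ ⊥
∣∣≡0⇒≡⊥ {S = []} e = refl
∣∣≡0⇒≡⊥ {S = false ∷ S} e = cong (false ∷_) (∣∣≡0⇒≡⊥ e)

⊥⊆ᵇ : ∀ (S : Subset n) → ⊥ ⊆ᵇ S ≡ true
⊥⊆ᵇ [] = refl
⊥⊆ᵇ (_ ∷ S) = ⊥⊆ᵇ S

⊆ᵇ⊥⇒≡⊥ : T ⊆ᵇ ⊥ ≡ true → T ≡ ⊥
⊆ᵇ⊥⇒≡⊥ {T = []} e = refl
⊆ᵇ⊥⇒≡⊥ {T = false ∷ T} e = cong (false ∷_) (⊆ᵇ⊥⇒≡⊥ e)

⊆ᵇ⁅⁆⇒∩∁≡⊥ : T ⊆ᵇ ⁅ j ⁆ ≡ true → T ≢ ⊥ → ⁅ j ⁆ ∩ ∁ T ≡ ⊥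
⊆ᵇ⁅⁆⇒∩∁≡⊥ {T = true ∷ T} {zero} e T≢⊥ = cong (false ∷_) (∩-zeroˡ _)
⊆ᵇ⁅⁆⇒∩∁≡⊥ {T = false ∷ T} {zero} e T≢⊥ = ⊥-elim (T≢⊥ (cong (false ∷_) (⊆ᵇ⊥⇒≡⊥ e)))
⊆ᵇ⁅⁆⇒∩∁≡⊥ {T = false ∷ T} {suc j} e T≢⊥ =
  cong (false ∷_) (⊆ᵇ⁅⁆⇒∩∁≡⊥ e (λ T≡⊥ → T≢⊥ (cong (false ∷_) T≡⊥)))

∩∁⊥ : ∀ (S : Subset n) → S ∩ ∁ ⊥ ≡ S
∩∁⊥ [] = refl
∩∁⊥ (true ∷ S) = cong (true ∷_) (∩∁⊥ S)
∩∁⊥ (false ∷ S) = cong (false ∷_) (∩∁⊥ S)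

inversions-⊥ : ∀ (U : Subset n) → inversions ⊥ U ≡ 0
inversions-⊥ [] = refl
inversions-⊥ {suc n} (true ∷ U) rewrite ∣⊥∣≡0 n = inversions-⊥ U
inversions-⊥ (false ∷ U) = inversions-⊥ U

∉-remove : ∀ (C : Subset n) i → i ∉ C ∩ ∁ ⁅ i ⁆
∉-remove C i i∈ = x∈p⇒x∉∁p (x∈⁅x⁆ i) (proj₂ (x∈p∩q⁻ C (∁ ⁅ i ⁆) i∈))

insert-remove : i ∈ C → C ≡ ⁅ i ⁆ ∪ (C ∩ ∁ ⁅ i ⁆)
insert-remove {i = i} {C} i∈C = ⊆-antisym into outof
  where
  into : C ⊆ ⁅ i ⁆ ∪ (C ∩ ∁ ⁅ i ⁆)
  into {x} x∈C with x ≟ i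
  ... | yes refl = x∈p∪q⁺ (inj₁ (x∈⁅x⁆ x))
  ... | no x≢i = x∈p∪q⁺ (inj₂ (x∈p∩q⁺ (x∈C , x∉p⇒x∈∁p (λ x∈ → x≢i (x∈⁅y⁆⇒x≡y i x∈)))))
  outof : ⁅ i ⁆ ∪ (C ∩ ∁ ⁅ i ⁆) ⊆ C
  outof {x} x∈ with x∈p∪q⁻ ⁅ i ⁆ _ x∈
  ... | inj₁ x∈⁅i⁆ rewrite x∈⁅y⁆⇒x≡y i x∈⁅i⁆ = i∈C
  ... | inj₂ x∈C∖i = proj₁ (x∈p∩q⁻ C _ x∈C∖i)

pair-remove : p ≢ q → (⁅ p ⁆ ∪ ⁅ q ⁆) ∩ ∁ ⁅ p ⁆ ≡ ⁅ q ⁆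
pair-remove {p = zero} {zero} p≢q = ⊥-elim (p≢q refl)
pair-remove {p = zero} {suc q} p≢q = cong (false ∷_) (≡.trans (cong (_∩ ∁ ⊥) (∪-identityˡ ⁅ q ⁆)) (∩∁⊥ _))
pair-remove {p = suc p} {zero} p≢q =
  cong (true ∷_) (≡.trans (cong (_∩ ∁ ⁅ p ⁆) (∪-identityʳ ⁅ p ⁆)) (∩-inverseʳ ⁅ p ⁆))
pair-remove {p = suc p} {suc q} p≢q = cong (false ∷_) (pair-remove (λ e → p≢q (cong suc e)))

below-⁅⁆ : ∀ (q : Fin n) → below ⁅ q ⁆ q ≡ 0
below-⁅⁆ zero = refl
below-⁅⁆ (suc q) = below-⁅⁆ q

below-pair : p ≢ q → below (⁅ p ⁆ ∪ ⁅ q ⁆) p ℕ.+ below (⁅ p ⁆ ∪ ⁅ q ⁆) q ≡ 1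
below-pair {p = zero} {zero} p≢q = ⊥-elim (p≢q refl)
below-pair {p = zero} {suc q} p≢q = cong suc (≡.trans (cong (λ X → below X q) (∪-identityˡ ⁅ q ⁆)) (below-⁅⁆ q))
below-pair {p = suc p} {zero} p≢q =
  ≡.trans (ℕ.+-identityʳ _) (cong suc (≡.trans (cong (λ X → below X p) (∪-identityʳ ⁅ p ⁆)) (below-⁅⁆ p)))
below-pair {p = suc p} {suc q} p≢q = below-pair (λ e → p≢q (cong suc e))

∣pair∣≡2 : p ≢ q → ∣ ⁅ p ⁆ ∪ ⁅ q ⁆ ∣ ≡ 2
∣pair∣≡2 {p = zero} {zero} p≢q = ⊥-elim (p≢q refl)
∣pair∣≡2 {p = zero} {suc q} p≢q = cong suc (≡.trans (cong ∣_∣ (∪-identityˡ ⁅ q ⁆)) (∣⁅x⁆∣≡1 q))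
∣pair∣≡2 {p = suc p} {zero} p≢q = cong suc (≡.trans (cong ∣_∣ (∪-identityʳ ⁅ p ⁆)) (∣⁅x⁆∣≡1 p))
∣pair∣≡2 {p = suc p} {suc q} p≢q = ∣pair∣≡2 (λ e → p≢q (cong suc e))

firstIndex : ∀ {m} → (Fin m → Bool) → Maybe (Fin m)
firstIndex {zero} P = nothing
firstIndex {suc m} P = if P zero then just zero else Maybe.map suc (firstIndex (λ i → P (suc i)))

firstIndex-cong : ∀ {m} {P Q : Fin m → Bool} → (∀ i → P i ≡ Q i) → firstIndex P ≡ firstIndex Q
firstIndex-cong {zero} P≗Q = refl
firstIndex-cong {suc m} {P} {Q} P≗Q
  rewrite P≗Q zero | firstIndex-cong {P = λ i → P (suc i)} {λ i → Q (suc i)} (λ i → P≗Q (suc i)) = refl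

firstIndex-sound : ∀ {m} (P : Fin m → Bool) {i} → firstIndex P ≡ just i → P i ≡ true
firstIndex-sound {suc m} P e with P zero in P0 | firstIndex (λ i → P (suc i)) in found
firstIndex-sound {suc m} P refl | true | _ = P0
firstIndex-sound {suc m} P refl | false | just i = firstIndex-sound (λ i → P (suc i)) found

firstIndex-complete : ∀ {m} (P : Fin m → Bool) {i} → P i ≡ true → ∃ λ j → firstIndex P ≡ just j
firstIndex-complete {suc m} P {i} Pi with P zero in P0
... | true = zero , refl
... | false with i
...   | zero = contradiction (≡.trans (≡.sym P0) Pi) λ ()
...   | suc i′ with firstIndex-complete (λ i → P (suc i)) Pi
...     | j , found = suc j , cong (Maybe.map suc) found

module _ {c ℓ} (K : Field c ℓ) where
  open Field K hiding (zero) renaming (refl to ≈-refl; reflexive to ≈-reflexive)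
  open OverField K
  open RingProperties ring
    using (-‿distribˡ-*; -0#≈0#; -‿distribʳ-*; -‿involutive; -1*x≈-x; +-inverseʳ-unique; x[y-z]≈xy-xz)
  open SemiringSum semiring using (sum; sum-cong-≗; ∑-distrib-+; ∑-comm; *-distribˡ-sum)
  open SetoidReasoning setoid

  private variable
    m : ℕ
    x y : Carrier

  x-0≈x : ∀ x → x - 0# ≈ x
  x-0≈x x = trans (+-congˡ -0#≈0#) (+-identityʳ x)

  when : Bool → Carrier → Carrier
  when b x = if b then x else 0#

  when-false : ∀ {b} x → b ≡ false → when b x ≈ 0#
  when-false x refl = ≈-refl

  when-cong : ∀ b → x ≈ y → when b x ≈ when b y
  when-cong true x≈y = x≈y
  when-cong false _ = ≈-refl

  when-*ˡ : ∀ b a x → when b (a * x) ≈ a * when b x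
  when-*ˡ true a x = ≈-refl
  when-*ˡ false a x = sym (zeroʳ a)

  when-− : ∀ b x y → when b (x - y) ≈ when b x - when b y
  when-− true x y = ≈-refl
  when-− false x y = sym (x-0≈x 0#)

  when-0 : ∀ b → when b 0# ≈ 0#
  when-0 true = ≈-refl
  when-0 false = ≈-refl

  when≈*indicator : ∀ b x → when b x ≈ x * when b 1#
  when≈*indicator true x = sym (*-identityʳ x)
  when≈*indicator false x = sym (zeroʳ x)

  sumFin≡sum : ∀ (f : Fin n → Carrier) → sumFin f ≡ sum f
  sumFin≡sum {zero} f = refl
  sumFin≡sum {suc n} f = cong (f zero +_) (sumFin≡sum (λ i → f (suc i)))

  sumFin-cong : {f g : Fin n → Carrier} → (∀ i → f i ≈ g i) → sumFin f ≈ sumFin g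
  sumFin-cong {zero} f≈g = ≈-refl
  sumFin-cong {suc n} f≈g = +-cong (f≈g zero) (sumFin-cong (λ i → f≈g (suc i)))

  sumFin-zero : ∀ {n} {f : Fin n → Carrier} → (∀ i → f i ≈ 0#) → sumFin f ≈ 0#
  sumFin-zero {zero} f≈0 = ≈-refl
  sumFin-zero {suc n} f≈0 = trans (+-cong (f≈0 zero) (sumFin-zero (λ i → f≈0 (suc i)))) (+-identityʳ 0#)

  sumFin-+ : ∀ (f g : Fin n → Carrier) → sumFin (λ i → f i + g i) ≈ sumFin f + sumFin g
  sumFin-+ f g = begin
    sumFin (λ i → f i + g i) ≡⟨ sumFin≡sum (λ i → f i + g i) ⟩
    sum (λ i → f i + g i)    ≈⟨ ∑-distrib-+ f g ⟩
    sum f + sum g            ≡⟨ ≡.cong₂ _+_ (sumFin≡sum f) (sumFin≡sum g) ⟨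
    sumFin f + sumFin g      ∎

  sumFin-*ˡ : ∀ a (f : Fin n → Carrier) → sumFin (λ i → a * f i) ≈ a * sumFin f
  sumFin-*ˡ a f = begin
    sumFin (λ i → a * f i) ≡⟨ sumFin≡sum (λ i → a * f i) ⟩
    sum (λ i → a * f i)    ≈⟨ *-distribˡ-sum a f ⟨
    a * sum f              ≡⟨ cong (a *_) (sumFin≡sum f) ⟨
    a * sumFin f           ∎

  sumFin-− : ∀ (f g : Fin n → Carrier) → sumFin (λ i → f i - g i) ≈ sumFin f - sumFin g
  sumFin-− f g = begin
    sumFin (λ i → f i - g i)             ≈⟨ sumFin-+ f (λ i → - g i) ⟩
    sumFin f + sumFin (λ i → - g i)      ≈⟨ +-congˡ (sumFin-cong (λ i → sym (-1*x≈-x (g i)))) ⟩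
    sumFin f + sumFin (λ i → - 1# * g i) ≈⟨ +-congˡ (sumFin-*ˡ (- 1#) g) ⟩
    sumFin f + - 1# * sumFin g           ≈⟨ +-congˡ (-1*x≈-x _) ⟩
    sumFin f - sumFin g                  ∎

  sumFin-comm : ∀ (f : Fin n → Fin m → Carrier) →
    sumFin (λ i → sumFin (λ j → f i j)) ≈ sumFin (λ j → sumFin (λ i → f i j))
  sumFin-comm f = begin
    sumFin (λ i → sumFin (λ j → f i j)) ≡⟨ double-sum f ⟩
    sum (λ i → sum (λ j → f i j))       ≈⟨ ∑-comm f ⟩
    sum (λ j → sum (λ i → f i j))       ≡⟨ double-sum (λ j i → f i j) ⟨
    sumFin (λ j → sumFin (λ i → f i j)) ∎
    where
    double-sum : ∀ {n m} (g : Fin n → Fin m → Carrier) →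
      sumFin (λ i → sumFin (g i)) ≡ sum (λ i → sum (g i))
    double-sum g = ≡.trans (sumFin≡sum (λ i → sumFin (g i))) (sum-cong-≗ (λ i → sumFin≡sum (g i)))

  sumFin-single : ∀ (f : Fin n → Carrier) k → (∀ i → i ≢ k → f i ≈ 0#) → sumFin f ≈ f k
  sumFin-single f zero off = trans (+-congˡ (sumFin-zero (λ i → off (suc i) λ ()))) (+-identityʳ _)
  sumFin-single f (suc k) off = trans (+-congʳ (off zero λ ()))
    (trans (+-identityˡ _) (sumFin-single (λ i → f (suc i)) k (λ i i≢k → off (suc i) (λ e → i≢k (suc-injective e)))))

  sumFin-indicator : ∀ (k : Fin n) (f : Fin n → Carrier) → sumFin (λ i → when (does (k ≟ i)) (f i)) ≈ f k
  sumFin-indicator k f = trans (sumFin-single _ k off) at-k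
    where
    off : ∀ i → i ≢ k → when (does (k ≟ i)) (f i) ≈ 0#
    off i i≢k rewrite dec-false (k ≟ i) (λ e → i≢k (≡.sym e)) = ≈-refl
    at-k : when (does (k ≟ k)) (f k) ≈ f k
    at-k rewrite dec-true (k ≟ k) refl = ≈-refl

  sumFin-fibres : ∀ (r : Fin m → Fin n) (g : Fin n → Carrier) (w : Fin m → Carrier) →
    sumFin (λ j → g (r j) * w j) ≈ sumFin (λ k → g k * sumFin (λ j → when (does (r j ≟ k)) (w j)))
  sumFin-fibres r g w = sym (begin
    sumFin (λ k → g k * sumFin (λ j → when (does (r j ≟ k)) (w j)))
      ≈⟨ sumFin-cong (λ k → sym (sumFin-*ˡ (g k) (λ j → when (does (r j ≟ k)) (w j)))) ⟩
    sumFin (λ k → sumFin (λ j → g k * when (does (r j ≟ k)) (w j)))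
      ≈⟨ sumFin-comm (λ k j → g k * when (does (r j ≟ k)) (w j)) ⟩
    sumFin (λ j → sumFin (λ k → g k * when (does (r j ≟ k)) (w j)))
      ≈⟨ sumFin-cong (λ j → sumFin-cong (λ k → sym (when-*ˡ (does (r j ≟ k)) (g k) (w j)))) ⟩
    sumFin (λ j → sumFin (λ k → when (does (r j ≟ k)) (g k * w j)))
      ≈⟨ sumFin-cong (λ j → sumFin-indicator (r j) (λ k → g k * w j)) ⟩
    sumFin (λ j → g (r j) * w j) ∎)

  sumSub-zero : {f : Subset n → Carrier} → (∀ S → f S ≈ 0#) → sumSub f ≈ 0#
  sumSub-zero {zero} f≈0 = f≈0 []
  sumSub-zero {suc n} f≈0 =
    trans (+-cong (sumSub-zero (λ T → f≈0 (outside ∷ T))) (sumSub-zero (λ T → f≈0 (inside ∷ T)))) (+-identityʳ 0#)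

  sumSub-single : ∀ (f : Subset n → Carrier) S → (∀ T → T ≢ S → f T ≈ 0#) → sumSub f ≈ f S
  sumSub-single {zero} f [] off = ≈-refl
  sumSub-single {suc n} f (false ∷ S) off =
    trans (+-congˡ (sumSub-zero (λ T → off (inside ∷ T) λ ())))
      (trans (+-identityʳ _) (sumSub-single (λ T → f (outside ∷ T)) S (λ T T≢S → off _ (λ e → T≢S (cong tail e)))))
  sumSub-single {suc n} f (true ∷ S) off =
    trans (+-congʳ (sumSub-zero (λ T → off (outside ∷ T) λ ())))
      (trans (+-identityˡ _) (sumSub-single (λ T → f (inside ∷ T)) S (λ T T≢S → off _ (λ e → T≢S (cong tail e)))))

  when-sumFin : ∀ b (f : Fin m → Carrier) → when b (sumFin f) ≈ sumFin (λ t → when b (f t))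
  when-sumFin true f = ≈-refl
  when-sumFin false f = sym (sumFin-zero {f = λ t → when false (f t)} (λ _ → ≈-refl))

  sumWhere : (Fin n → Bool) → (Fin n → Carrier) → Carrier
  sumWhere P f = sumFin (λ j → when (P j) (f j))

  sumWhere-cong : ∀ P {f g : Fin n → Carrier} → (∀ j → f j ≈ g j) → sumWhere P f ≈ sumWhere P g
  sumWhere-cong P f≈g = sumFin-cong (λ j → when-cong (P j) (f≈g j))

  sumWhere-*ˡ : ∀ P a (f : Fin n → Carrier) → sumWhere P (λ j → a * f j) ≈ a * sumWhere P f
  sumWhere-*ˡ P a f = trans (sumFin-cong (λ j → when-*ˡ (P j) a (f j))) (sumFin-*ˡ a (λ j → when (P j) (f j)))

  sumWhere-− : ∀ P (f g : Fin n → Carrier) → sumWhere P (λ j → f j - g j) ≈ sumWhere P f - sumWhere P g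
  sumWhere-− P f g = trans (sumFin-cong (λ j → when-− (P j) (f j) (g j)))
    (sumFin-− (λ j → when (P j) (f j)) (λ j → when (P j) (g j)))

  sumWhere-sumFin : ∀ P (f : Fin m → Fin n → Carrier) →
    sumWhere P (λ j → sumFin (λ t → f t j)) ≈ sumFin (λ t → sumWhere P (f t))
  sumWhere-sumFin P f = trans (sumFin-cong (λ j → when-sumFin (P j) (λ t → f t j)))
    (sumFin-comm (λ j t → when (P j) (f t j)))

  negPow-zero : ∀ k → x ≈ 0# → negPow k x ≈ 0#
  negPow-zero zero x≈0 = x≈0
  negPow-zero (suc k) x≈0 = trans (-‿cong (negPow-zero k x≈0)) -0#≈0#

  sign-square : ∀ k → negPow k 1# * negPow k 1# ≈ 1#
  sign-square zero = *-identityˡ 1#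
  sign-square (suc k) = begin
    - s * - s     ≈⟨ -‿distribˡ-* s (- s) ⟨
    - (s * - s)   ≈⟨ -‿cong (-‿distribʳ-* s s) ⟨
    - (- (s * s)) ≈⟨ -‿involutive (s * s) ⟩
    s * s         ≈⟨ sign-square k ⟩
    1#            ∎
    where s = negPow k 1#

  sign-sum : ∀ a b → a ℕ.+ b ≡ 1 → negPow a 1# + negPow b 1# ≈ 0#
  sign-sum zero (suc zero) _ = -‿inverseʳ 1#
  sign-sum (suc zero) zero _ = -‿inverseˡ 1#

  *-cancel-≉0 : ∀ {a b} → ¬ (a ≈ 0#) → a * b ≈ 0# → b ≈ 0#
  *-cancel-≉0 {a} {b} a≉0 ab≈0 with inverse a a≉0
  ... | a⁻¹ , aa⁻¹≈1 = begin
    b               ≈⟨ *-identityˡ b ⟨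
    1# * b          ≈⟨ *-congʳ (trans (sym aa⁻¹≈1) (*-comm a a⁻¹)) ⟩
    (a⁻¹ * a) * b   ≈⟨ *-assoc a⁻¹ a b ⟩
    a⁻¹ * (a * b)   ≈⟨ *-congˡ ab≈0 ⟩
    a⁻¹ * 0#        ≈⟨ zeroʳ a⁻¹ ⟩
    0#              ∎

  -- Degrees 0 and 1 of the exterior algebra

  basis : Fin n → Ext n
  basis k S = when (S ==ˢ ⁅ k ⁆) 1#

  1ᴱ : Ext n
  1ᴱ S = when (S ==ˢ ⊥) 1#

  coords : Ext n → Vect n
  coords y j = y ⁅ j ⁆

  1ᴱ-⊥ : 1ᴱ {n} ⊥ ≈ 1#
  1ᴱ-⊥ {n} rewrite ==ˢ-refl (⊥ {n}) = ≈-refl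

  1ᴱ-homog : Homog 0 (1ᴱ {n})
  1ᴱ-homog {n} S ∣S∣≢0 =
    when-false 1# (≢⇒==ˢ-false {S = S} {⊥} (λ S≡⊥ → ∣S∣≢0 (≡.trans (cong ∣_∣ S≡⊥) (∣⊥∣≡0 n))))

  homog-·ᴱ : ∀ {p} a {y : Ext n} → Homog p y → Homog p (a ·ᴱ y)
  homog-·ᴱ a y-homog S ∣S∣≢p = trans (*-congˡ (y-homog S ∣S∣≢p)) (zeroʳ a)

  homog0-off-⊥ : ∀ {a : Ext n} → Homog 0 a → ∀ T → T ≢ ⊥ → a T ≈ 0#
  homog0-off-⊥ a-homog T T≢⊥ = a-homog T (λ ∣T∣≡0 → T≢⊥ (∣∣≡0⇒≡⊥ ∣T∣≡0))

  ∧ᴱ-only-⊥-term : ∀ (a y : Ext n) S → (∀ T → T ≢ ⊥ → T ⊆ᵇ S ≡ true → a T * y (S ∩ ∁ T) ≈ 0#) →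
    (a ∧ᴱ y) S ≈ a ⊥ * y S
  ∧ᴱ-only-⊥-term a y S others = trans (sumSub-single _ ⊥ off) at-⊥
    where
    off : ∀ T → T ≢ ⊥ → (if T ⊆ᵇ S then negPow (inversions T (S ∩ ∁ T)) (a T * y (S ∩ ∁ T)) else 0#) ≈ 0#
    off T T≢⊥ with T ⊆ᵇ S in T⊆S
    ... | true = negPow-zero (inversions T (S ∩ ∁ T)) (others T T≢⊥ T⊆S)
    ... | false = ≈-refl
    at-⊥ : (if ⊥ ⊆ᵇ S then negPow (inversions ⊥ (S ∩ ∁ ⊥)) (a ⊥ * y (S ∩ ∁ ⊥)) else 0#) ≈ a ⊥ * y S
    at-⊥ rewrite ⊥⊆ᵇ S | inversions-⊥ (S ∩ ∁ ⊥) | ∩∁⊥ S = ≈-refl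

  ∧ᴱ-at-⊥ : ∀ (a y : Ext n) → (a ∧ᴱ y) ⊥ ≈ a ⊥ * y ⊥
  ∧ᴱ-at-⊥ a y = ∧ᴱ-only-⊥-term a y ⊥ (λ T T≢⊥ T⊆⊥ → ⊥-elim (T≢⊥ (⊆ᵇ⊥⇒≡⊥ T⊆⊥)))

  ∧ᴱ-at-⁅⁆ : ∀ (a y : Ext n) j → y ⊥ ≈ 0# → (a ∧ᴱ y) ⁅ j ⁆ ≈ a ⊥ * y ⁅ j ⁆
  ∧ᴱ-at-⁅⁆ a y j y⊥≈0 = ∧ᴱ-only-⊥-term a y ⁅ j ⁆ others
    where
    others : ∀ T → T ≢ ⊥ → T ⊆ᵇ ⁅ j ⁆ ≡ true → a T * y (⁅ j ⁆ ∩ ∁ T) ≈ 0#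
    others T T≢⊥ T⊆j rewrite ⊆ᵇ⁅⁆⇒∩∁≡⊥ T⊆j T≢⊥ = trans (*-congˡ y⊥≈0) (zeroʳ _)

  scalar-∧ᴱ : ∀ {a : Ext n} → Homog 0 a → ∀ y → (a ∧ᴱ y) ≈ᴱ (a ⊥ ·ᴱ y)
  scalar-∧ᴱ {a = a} a-homog y S = ∧ᴱ-only-⊥-term a y S
    (λ T T≢⊥ _ → trans (*-congʳ (homog0-off-⊥ a-homog T T≢⊥)) (zeroˡ _))

  ι-basis : ∀ (v : Vect n) S → ι v S ≈ sumFin (λ j → v j * basis j S)
  ι-basis v S = sumFin-cong (λ j → when≈*indicator (S ==ˢ ⁅ j ⁆) (v j))

  ι-⁅⁆ : ∀ (v : Vect n) k → ι v ⁅ k ⁆ ≈ v k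
  ι-⁅⁆ v k = trans (sumFin-single _ k off) at-k
    where
    off : ∀ j → j ≢ k → when (⁅ k ⁆ ==ˢ ⁅ j ⁆) (v j) ≈ 0#
    off j j≢k rewrite ≢⇒==ˢ-false (λ e → j≢k (≡.sym (⁅⁆-injective e))) = ≈-refl
    at-k : when (⁅ k ⁆ ==ˢ ⁅ k ⁆) (v k) ≈ v k
    at-k rewrite ==ˢ-refl ⁅ k ⁆ = ≈-refl

  sumWhere-basis : ∀ P (q : Fin n) → sumWhere P (coords (basis q)) ≈ when (P q) 1#
  sumWhere-basis P q = trans (sumFin-single _ q off) at-q
    where
    off : ∀ j → j ≢ q → when (P j) (when (⁅ j ⁆ ==ˢ ⁅ q ⁆) 1#) ≈ 0#
    off j j≢q rewrite ≢⇒==ˢ-false (λ e → j≢q (⁅⁆-injective e)) = when-0 (P j)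
    at-q : when (P q) (when (⁅ q ⁆ ==ˢ ⁅ q ⁆) 1#) ≈ when (P q) 1#
    at-q rewrite ==ˢ-refl ⁅ q ⁆ = ≈-refl

  ∂e-vanishes : ∀ (C T : Subset n) → (∀ i → i ∈ C → C ∩ ∁ ⁅ i ⁆ ≢ T) → ∂e C T ≈ 0#
  ∂e-vanishes C T no-term = sumFin-zero term
    where
    term : ∀ i → (if (i ∈ᵇ C) ∧ (T ==ˢ (C ∩ ∁ ⁅ i ⁆)) then negPow (below C i) 1# else 0#) ≈ 0#
    term i with i ∈ᵇ C in i∈C | T ==ˢ (C ∩ ∁ ⁅ i ⁆) in T≡C∖i
    ... | true | true = ⊥-elim (no-term i (∈ᵇ⇒∈ i∈C) (≡.sym (==ˢ⇒≡ T≡C∖i)))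
    ... | true | false = ≈-refl
    ... | false | _ = ≈-refl

  ∂e-at-⁅⁆ : ∀ (C : Subset n) j → (∀ i → i ≢ j → C ≢ ⁅ i ⁆ ∪ ⁅ j ⁆) → ∂e C ⁅ j ⁆ ≈ 0#
  ∂e-at-⁅⁆ C j not-pair = ∂e-vanishes C ⁅ j ⁆ λ i i∈C C∖i≡j →
    not-pair i (i≢j i∈C C∖i≡j) (≡.trans (insert-remove i∈C) (cong (⁅ i ⁆ ∪_) C∖i≡j))
    where
    i≢j : ∀ {i} → i ∈ C → C ∩ ∁ ⁅ i ⁆ ≡ ⁅ j ⁆ → i ≢ j
    i≢j {i} _ C∖i≡j refl = ∉-remove C i (subst (i ∈_) (≡.sym C∖i≡j) (x∈⁅x⁆ i))

  ∂e-pair-terms : ∀ {p q : Fin n} → p ≢ q → ∀ S → let P = ⁅ p ⁆ ∪ ⁅ q ⁆ in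
    ∂e P S ≈ when (S ==ˢ ⁅ q ⁆) (negPow (below P p) 1#) + when (S ==ˢ ⁅ p ⁆) (negPow (below P q) 1#)
  ∂e-pair-terms {p = p} {q} p≢q S = begin
    ∂e P S                                    ≈⟨ sumFin-cong (λ i → term-≈ i (p ≟ i) (q ≟ i)) ⟩
    sumFin (λ i → term i (p ≟ i) (q ≟ i))
      ≈⟨ sumFin-+ (λ i → when (does (p ≟ i)) s′) (λ i → when (does (q ≟ i)) t′) ⟩
    sumFin (λ i → when (does (p ≟ i)) s′) + sumFin (λ i → when (does (q ≟ i)) t′)
      ≈⟨ +-cong (sumFin-indicator p (λ _ → s′)) (sumFin-indicator q (λ _ → t′)) ⟩
    s′ + t′                                   ∎
    where
    P = ⁅ p ⁆ ∪ ⁅ q ⁆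
    s′ = when (S ==ˢ ⁅ q ⁆) (negPow (below P p) 1#)
    t′ = when (S ==ˢ ⁅ p ⁆) (negPow (below P q) 1#)
    p∈P : p ∈ P
    p∈P = x∈p∪q⁺ (inj₁ (x∈⁅x⁆ p))
    q∈P : q ∈ P
    q∈P = x∈p∪q⁺ (inj₂ (x∈⁅x⁆ q))
    P∖q : P ∩ ∁ ⁅ q ⁆ ≡ ⁅ p ⁆
    P∖q = ≡.trans (cong (_∩ ∁ ⁅ q ⁆) (∪-comm ⁅ p ⁆ ⁅ q ⁆)) (pair-remove (λ e → p≢q (≡.sym e)))
    ∉P : ∀ {i} → p ≢ i → q ≢ i → i ∉ P
    ∉P p≢i q≢i i∈P with x∈p∪q⁻ ⁅ p ⁆ ⁅ q ⁆ i∈P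
    ... | inj₁ i∈p = p≢i (≡.sym (x∈⁅y⁆⇒x≡y p i∈p))
    ... | inj₂ i∈q = q≢i (≡.sym (x∈⁅y⁆⇒x≡y q i∈q))
    term : ∀ i → Dec (p ≡ i) → Dec (q ≡ i) → Carrier
    term i d₁ d₂ = when (does d₁) s′ + when (does d₂) t′
    term-≈ : ∀ i d₁ d₂ →
      (if (i ∈ᵇ P) ∧ (S ==ˢ (P ∩ ∁ ⁅ i ⁆)) then negPow (below P i) 1# else 0#) ≈ term i d₁ d₂
    term-≈ i (yes refl) (yes refl) = ⊥-elim (p≢q refl)
    term-≈ i (yes refl) (no _) rewrite ∈⇒∈ᵇ p∈P | pair-remove p≢q = sym (+-identityʳ _)
    term-≈ i (no _) (yes refl) rewrite ∈⇒∈ᵇ q∈P | P∖q = sym (+-identityˡ _)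
    term-≈ i (no p≢i) (no q≢i) rewrite ∉⇒∈ᵇ-false (∉P p≢i q≢i) = sym (+-identityʳ 0#)

  ∂e-pair : ∀ {p q : Fin n} → p ≢ q →
    ∃ λ s → s * s ≈ 1# × ∂e (⁅ p ⁆ ∪ ⁅ q ⁆) ≈ᴱ (s ·ᴱ (basis q -ᴱ basis p))
  ∂e-pair {p = p} {q} p≢q = s , sign-square (below P p) , λ S → begin
    ∂e P S                                          ≈⟨ ∂e-pair-terms p≢q S ⟩
    when (S ==ˢ ⁅ q ⁆) s + when (S ==ˢ ⁅ p ⁆) t     ≈⟨ +-congˡ (when-cong (S ==ˢ ⁅ p ⁆) t≈-s) ⟩
    when (S ==ˢ ⁅ q ⁆) s + when (S ==ˢ ⁅ p ⁆) (- s) ≈⟨ +-cong (when≈*indicator _ s) (when≈*indicator _ (- s)) ⟩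
    s * basis q S + - s * basis p S                 ≈⟨ +-congˡ (-‿distribˡ-* s (basis p S)) ⟨
    s * basis q S - s * basis p S                   ≈⟨ x[y-z]≈xy-xz s (basis q S) (basis p S) ⟨
    s * (basis q S - basis p S)                     ∎
    where
    P = ⁅ p ⁆ ∪ ⁅ q ⁆
    s = negPow (below P p) 1#
    t = negPow (below P q) 1#
    t≈-s : t ≈ - s
    t≈-s = +-inverseʳ-unique s t (sign-sum (below P p) (below P q) (below-pair p≢q))

  1ᴱ-∧ᴱ : ∀ (y : Ext n) → (1ᴱ ∧ᴱ y) ≈ᴱ y
  1ᴱ-∧ᴱ {n} y S = trans (scalar-∧ᴱ (1ᴱ-homog {n}) y S) (trans (*-congʳ (1ᴱ-⊥ {n})) (*-identityˡ (y S)))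

  homog0-≈0ᴱ : ∀ {a : Ext n} → Homog 0 a → a ⊥ ≈ 0# → a ≈ᴱ 0ᴱ
  homog0-≈0ᴱ a-homog a⊥≈0 S with ≡-dec _≟ᵇ_ S ⊥
  ... | yes refl = a⊥≈0
  ... | no S≢⊥ = homog0-off-⊥ a-homog S S≢⊥

  -- The ideal I(M)

  module _ {n : ℕ} (M : Matroid n) where
    open Matroid M

    InI-cong : ∀ {x y : Ext n} → x ≈ᴱ y → InI M x → InI M y
    InI-cong x≈y (m , a , C , circuits , x≈) = m , a , C , circuits , λ S → trans (sym (x≈y S)) (x≈ S)

    InI-0ᴱ : InI M 0ᴱ
    InI-0ᴱ = 0 , (λ ()) , (λ ()) , (λ ()) , λ _ → ≈-refl

    InI-generator : ∀ a {C} → Circuit C → InI M (a ∧ᴱ ∂e C)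
    InI-generator a {C} circuit = 1 , (λ _ → a) , (λ _ → C) , (λ _ → circuit) , λ S → sym (+-identityʳ _)

    generators-+-InI : ∀ m (a : Fin m → Ext n) (C : Fin m → Subset n) → (∀ j → Circuit (C j)) →
      ∀ {y} → InI M y → InI M (sumᴱ (λ j → a j ∧ᴱ ∂e (C j)) +ᴱ y)
    generators-+-InI zero a C _ y∈I = InI-cong (λ S → sym (+-identityˡ _)) y∈I
    generators-+-InI (suc m) a C circuits y∈I
      with generators-+-InI m (λ j → a (suc j)) (λ j → C (suc j)) (λ j → circuits (suc j)) y∈I
    ... | m′ , b , D , circuits′ , rest≈ =
      suc m′ , a zero ◂ b , C zero ◂ D , (λ { zero → circuits zero ; (suc j) → circuits′ j }) ,
      λ S → trans (+-assoc _ _ _) (+-congˡ (rest≈ S))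

    InI-+ : ∀ {x y : Ext n} → InI M x → InI M y → InI M (x +ᴱ y)
    InI-+ (m , a , C , circuits , x≈) y∈I =
      InI-cong (λ S → +-congʳ (sym (x≈ S))) (generators-+-InI m a C circuits y∈I)

    InI-sumᴱ : ∀ {m} (f : Fin m → Ext n) → (∀ j → InI M (f j)) → InI M (sumᴱ f)
    InI-sumᴱ {zero} f _ = InI-0ᴱ
    InI-sumᴱ {suc m} f f∈I = InI-+ (f∈I zero) (InI-sumᴱ (λ j → f (suc j)) (λ j → f∈I (suc j)))

    InI⊆ker : (φ : Ext n → Carrier) → (∀ {x y} → x ≈ᴱ y → φ x ≈ φ y) →
      (∀ {m} (f : Fin m → Ext n) → φ (sumᴱ f) ≈ sumFin (λ t → φ (f t))) →
      (∀ a C → Circuit C → φ (a ∧ᴱ ∂e C) ≈ 0#) →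
      ∀ {x} → InI M x → φ x ≈ 0#
    InI⊆ker φ φ-cong φ-sumᴱ φ-generator (m , a , C , circuits , x≈) =
      trans (φ-cong x≈) (trans (φ-sumᴱ (λ t → a t ∧ᴱ ∂e (C t)))
        (sumFin-zero (λ t → φ-generator (a t) (C t) (circuits t))))

    -- Parallel elements of a loopless matroid

    module _ (loopless : Loopless M) where

      _∼_ : Fin n → Fin n → Set
      i ∼ j = related M i j ≡ true

      ∼-cases : ∀ {i j} → i ∼ j → i ≡ j ⊎ (i ≢ j × Dependent (⁅ i ⁆ ∪ ⁅ j ⁆))
      ∼-cases {i} {j} i∼j with i ≟ j | indep (⁅ i ⁆ ∪ ⁅ j ⁆)
      ... | yes i≡j | _ = inj₁ i≡j
      ... | no i≢j | false = inj₂ (i≢j , refl)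

      ≡⇒∼ : ∀ {i j} → i ≡ j → i ∼ j
      ≡⇒∼ {i} {j} i≡j rewrite dec-true (i ≟ j) i≡j = refl

      dependent⇒∼ : ∀ {i j} → Dependent (⁅ i ⁆ ∪ ⁅ j ⁆) → i ∼ j
      dependent⇒∼ dep rewrite dep = ∨-zeroʳ _

      ∼-refl : ∀ i → i ∼ i
      ∼-refl i = ≡⇒∼ refl

      ∼-sym : ∀ {i j} → i ∼ j → j ∼ i
      ∼-sym {i} {j} i∼j with ∼-cases i∼j
      ... | inj₁ i≡j = ≡⇒∼ (≡.sym i≡j)
      ... | inj₂ (_ , dep) = dependent⇒∼ (≡.trans (cong indep (∪-comm ⁅ j ⁆ ⁅ i ⁆)) dep)

      -- If {i, k} were independent, augmenting {j} from it would give an independent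
      -- pair {j, i} or {j, k}.
      dependent-pair-trans : ∀ {i j k} → i ≢ k → Dependent (⁅ i ⁆ ∪ ⁅ j ⁆) → Dependent (⁅ j ⁆ ∪ ⁅ k ⁆) →
        Dependent (⁅ i ⁆ ∪ ⁅ k ⁆)
      dependent-pair-trans {i} {j} {k} i≢k dep-ij dep-jk with indep (⁅ i ⁆ ∪ ⁅ k ⁆) in ind-ik
      ... | false = refl
      ... | true with indep-exchange {⁅ j ⁆} (loopless j) ind-ik
                        (subst₂ ℕ._<_ (≡.sym (∣⁅x⁆∣≡1 j)) (≡.sym (∣pair∣≡2 i≢k)) (s≤s (s≤s z≤n)))
      ... | x , x∈ik , _ , ind with x∈p∪q⁻ ⁅ i ⁆ ⁅ k ⁆ x∈ik
      ...   | inj₁ x∈i rewrite x∈⁅y⁆⇒x≡y i x∈i =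
                 contradiction (≡.trans (≡.sym ind) (≡.trans (cong indep (∪-comm ⁅ j ⁆ ⁅ i ⁆)) dep-ij)) λ ()
      ...   | inj₂ x∈k rewrite x∈⁅y⁆⇒x≡y k x∈k = contradiction (≡.trans (≡.sym ind) dep-jk) λ ()

      ∼-trans : ∀ {i j k} → i ∼ j → j ∼ k → i ∼ k
      ∼-trans {i} {j} {k} i∼j j∼k = from-cases (∼-cases i∼j) (∼-cases j∼k)
        where
        from-cases : i ≡ j ⊎ (i ≢ j × Dependent (⁅ i ⁆ ∪ ⁅ j ⁆)) →
                     j ≡ k ⊎ (j ≢ k × Dependent (⁅ j ⁆ ∪ ⁅ k ⁆)) → i ∼ k
        from-cases (inj₁ refl) _ = j∼k
        from-cases (inj₂ _) (inj₁ refl) = i∼j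
        from-cases (inj₂ (_ , dep-ij)) (inj₂ (_ , dep-jk)) with i ≟ k
        ... | yes _ = refl
        ... | no i≢k rewrite dependent-pair-trans i≢k dep-ij dep-jk = refl

      ∼⇒related-≡ˡ : ∀ {i j} → i ∼ j → ∀ k → related M i k ≡ related M j k
      ∼⇒related-≡ˡ i∼j k = ⇔→≡ (mk⇔ (∼-trans (∼-sym i∼j)) (∼-trans i∼j))

      ∼⇒related-≡ʳ : ∀ {i j} → i ∼ j → ∀ k → related M k i ≡ related M k j
      ∼⇒related-≡ʳ i∼j k = ⇔→≡ (mk⇔ (λ k∼i → ∼-trans k∼i i∼j) (λ k∼j → ∼-trans k∼j (∼-sym i∼j)))

      pair-circuit : ∀ {p q} → p ≢ q → Dependent (⁅ p ⁆ ∪ ⁅ q ⁆) → Circuit (⁅ p ⁆ ∪ ⁅ q ⁆)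
      pair-circuit {p} {q} p≢q dep = dep , proper-subsets-independent
        where
        proper-subsets-independent : ∀ D → D ⊂ ⁅ p ⁆ ∪ ⁅ q ⁆ → Independent D
        proper-subsets-independent D (D⊆pq , x , x∈pq , x∉D) with x∈p∪q⁻ ⁅ p ⁆ ⁅ q ⁆ x∈pq
        ... | inj₁ x∈p rewrite x∈⁅y⁆⇒x≡y p x∈p = indep-⊆ (loopless q) D⊆q
          where
          D⊆q : D ⊆ ⁅ q ⁆
          D⊆q y∈D with x∈p∪q⁻ ⁅ p ⁆ ⁅ q ⁆ (D⊆pq y∈D)
          ... | inj₁ y∈p rewrite x∈⁅y⁆⇒x≡y p y∈p = ⊥-elim (x∉D y∈D)
          ... | inj₂ y∈q = y∈q
        ... | inj₂ x∈q rewrite x∈⁅y⁆⇒x≡y q x∈q = indep-⊆ (loopless p) D⊆p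
          where
          D⊆p : D ⊆ ⁅ p ⁆
          D⊆p y∈D with x∈p∪q⁻ ⁅ p ⁆ ⁅ q ⁆ (D⊆pq y∈D)
          ... | inj₁ y∈p = y∈p
          ... | inj₂ y∈q rewrite x∈⁅y⁆⇒x≡y q y∈q = ⊥-elim (x∉D y∈D)

      dependent-∂e-⊥ : ∀ {C} → Dependent C → ∂e C ⊥ ≈ 0#
      dependent-∂e-⊥ {C} dep = ∂e-vanishes C ⊥ λ i i∈C C∖i≡⊥ →
        contradiction (≡.trans (≡.sym (indep-⊆ (loopless i) (C⊆i i∈C C∖i≡⊥))) dep) λ ()
        where
        C⊆i : ∀ {i} → i ∈ C → C ∩ ∁ ⁅ i ⁆ ≡ ⊥ → C ⊆ ⁅ i ⁆
        C⊆i {i} i∈C C∖i≡⊥ =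
          ⊆-reflexive (≡.trans (insert-remove i∈C) (≡.trans (cong (⁅ i ⁆ ∪_) C∖i≡⊥) (∪-identityʳ ⁅ i ⁆)))

      InI-at-⊥ : ∀ {x} → InI M x → x ⊥ ≈ 0#
      InI-at-⊥ = InI⊆ker (λ y → y ⊥) (λ x≈y → x≈y ⊥) (λ _ → ≈-refl)
        (λ a C circuit → trans (∧ᴱ-at-⊥ a (∂e C)) (trans (*-congˡ (dependent-∂e-⊥ (proj₁ circuit))) (zeroʳ _)))

      -- Block sums over parallel classes

      blockSum : Fin n → Ext n → Carrier
      blockSum i y = sumWhere (related M i) (coords y)

      blockSum-∂e-pair : ∀ {p q} → p ≢ q → q ∼ p → ∀ i → blockSum i (∂e (⁅ p ⁆ ∪ ⁅ q ⁆)) ≈ 0#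
      blockSum-∂e-pair {p} {q} p≢q q∼p i with ∂e-pair p≢q
      ... | s , _ , ∂e≈ = begin
        blockSum i (∂e (⁅ p ⁆ ∪ ⁅ q ⁆))
          ≈⟨ sumWhere-cong (related M i) (λ j → ∂e≈ ⁅ j ⁆) ⟩
        sumWhere (related M i) (λ j → s * (basis q ⁅ j ⁆ - basis p ⁅ j ⁆))
          ≈⟨ sumWhere-*ˡ (related M i) s _ ⟩
        s * sumWhere (related M i) (λ j → basis q ⁅ j ⁆ - basis p ⁅ j ⁆)
          ≈⟨ *-congˡ (sumWhere-− (related M i) (coords (basis q)) (coords (basis p))) ⟩
        s * (blockSum i (basis q) - blockSum i (basis p))
          ≈⟨ *-congˡ (+-cong (sumWhere-basis (related M i) q) (-‿cong (sumWhere-basis (related M i) p))) ⟩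
        s * (when (related M i q) 1# - when (related M i p) 1#)
          ≈⟨ *-congˡ (≈-reflexive (cong (λ b → when b 1# - when (related M i p) 1#) (∼⇒related-≡ʳ q∼p i))) ⟩
        s * (when (related M i p) 1# - when (related M i p) 1#)
          ≈⟨ *-congˡ (-‿inverseʳ _) ⟩
        s * 0#
          ≈⟨ zeroʳ s ⟩
        0# ∎

      blockSum-∂e-circuit : ∀ {C} → Circuit C → ∀ i → blockSum i (∂e C) ≈ 0#
      blockSum-∂e-circuit {C} circuit i
        with any? (λ p → any? (λ q → ¬? (p ≟ q) ×-dec ≡-dec _≟ᵇ_ C (⁅ p ⁆ ∪ ⁅ q ⁆)))
      ... | yes (p , q , p≢q , refl) = blockSum-∂e-pair p≢q (∼-sym (dependent⇒∼ (proj₁ circuit))) i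
      ... | no not-pair = sumFin-zero (λ j →
              trans (when-cong (related M i j) (∂e-at-⁅⁆ C j (λ p p≢j C≡pj → not-pair (p , j , p≢j , C≡pj))))
                    (when-0 (related M i j)))

      blockSum-kills-I : ∀ i {x} → InI M x → blockSum i x ≈ 0#
      blockSum-kills-I i = InI⊆ker (blockSum i)
        (λ x≈y → sumWhere-cong (related M i) (λ j → x≈y ⁅ j ⁆))
        (λ f → sumWhere-sumFin (related M i) (λ t j → f t ⁅ j ⁆))
        (λ a C circuit → begin
          blockSum i (a ∧ᴱ ∂e C)
            ≈⟨ sumWhere-cong (related M i) (λ j → ∧ᴱ-at-⁅⁆ a (∂e C) j (dependent-∂e-⊥ (proj₁ circuit))) ⟩
          sumWhere (related M i) (λ j → a ⊥ * ∂e C ⁅ j ⁆)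
            ≈⟨ sumWhere-*ˡ (related M i) (a ⊥) (coords (∂e C)) ⟩
          a ⊥ * blockSum i (∂e C)
            ≈⟨ *-congˡ (blockSum-∂e-circuit circuit i) ⟩
          a ⊥ * 0#
            ≈⟨ zeroʳ (a ⊥) ⟩
          0# ∎)


      rep : Fin n → Fin n
      rep i = fromMaybe i (firstIndex (related M i))

      rep-∼ : ∀ i → rep i ∼ i
      rep-∼ i with firstIndex-complete (related M i) (∼-refl i)
      ... | j , found rewrite found = ∼-sym (firstIndex-sound (related M i) found)

      ∼⇒rep≡ : ∀ {i j} → i ∼ j → rep i ≡ rep j
      ∼⇒rep≡ {i} {j} i∼j with firstIndex-complete (related M i) (∼-refl i)
      ... | k , found = ≡.trans (cong (fromMaybe i) found)
                          (cong (fromMaybe j) (≡.trans (≡.sym found) (firstIndex-cong (∼⇒related-≡ˡ i∼j))))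

      rep-fibre-sum : ∀ {v} → Pπ M v → ∀ k → sumFin (λ j → when (does (rep j ≟ k)) (v j)) ≈ 0#
      rep-fibre-sum {v} pπ k with rep k ≟ k
      ... | yes rep-k≡k = trans (sumFin-cong (λ j → ≈-reflexive (cong (λ b → when b (v j)) (fibre≡class j)))) (pπ k)
        where
        fibre≡class : ∀ j → does (rep j ≟ k) ≡ related M k j
        fibre≡class j with rep j ≟ k | related M k j in k∼j
        ... | yes refl | true = refl
        ... | yes refl | false = ≡.trans (≡.sym (rep-∼ j)) k∼j
        ... | no rep-j≢k | true = ⊥-elim (rep-j≢k (≡.trans (≡.sym (∼⇒rep≡ k∼j)) rep-k≡k))
        ... | no _ | false = refl
      ... | no rep-k≢k = sumFin-zero (λ j → when-false (v j) (dec-false (rep j ≟ k) (λ rep-j≡k →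
              rep-k≢k (≡.trans (cong rep (≡.sym rep-j≡k)) (≡.trans (∼⇒rep≡ (rep-∼ j)) rep-j≡k)))))

      basis-diff∈I : ∀ {p q} → p ∼ q → ∀ c → InI M (c ·ᴱ (basis q -ᴱ basis p))
      basis-diff∈I {p} {q} p∼q c with ∼-cases p∼q
      ... | inj₁ refl = InI-cong (λ S → sym (trans (*-congˡ (-‿inverseʳ _)) (zeroʳ c))) InI-0ᴱ
      ... | inj₂ (p≢q , dep) with ∂e-pair p≢q
      ...   | s , s*s≈1 , ∂e≈ = InI-cong generator≈ (InI-generator ((c * s) ·ᴱ 1ᴱ) (pair-circuit p≢q dep))
        where
        generator≈ : (((c * s) ·ᴱ 1ᴱ) ∧ᴱ ∂e (⁅ p ⁆ ∪ ⁅ q ⁆)) ≈ᴱ (c ·ᴱ (basis q -ᴱ basis p))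
        generator≈ S = begin
          (((c * s) ·ᴱ 1ᴱ) ∧ᴱ ∂e (⁅ p ⁆ ∪ ⁅ q ⁆)) S
            ≈⟨ scalar-∧ᴱ (homog-·ᴱ (c * s) (1ᴱ-homog {n})) (∂e (⁅ p ⁆ ∪ ⁅ q ⁆)) S ⟩
          ((c * s) * 1ᴱ {n} ⊥) * ∂e (⁅ p ⁆ ∪ ⁅ q ⁆) S
            ≈⟨ *-cong (trans (*-congˡ (1ᴱ-⊥ {n})) (*-identityʳ _)) (∂e≈ S) ⟩
          (c * s) * (s * d)   ≈⟨ *-assoc c s (s * d) ⟩
          c * (s * (s * d))   ≈⟨ *-congˡ (*-assoc s s d) ⟨
          c * ((s * s) * d)   ≈⟨ *-congˡ (trans (*-congʳ s*s≈1) (*-identityˡ d)) ⟩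
          c * d               ∎
          where d = basis q S - basis p S

      ι≈basis-diffs : ∀ {v} → Pπ M v → ι v ≈ᴱ sumᴱ (λ j → v j ·ᴱ (basis j -ᴱ basis (rep j)))
      ι≈basis-diffs {v} pπ S = begin
        ι v S
          ≈⟨ ι-basis v S ⟩
        sumFin (λ j → v j * basis j S)
          ≈⟨ x-0≈x _ ⟨
        sumFin (λ j → v j * basis j S) - 0#
          ≈⟨ +-congˡ (-‿cong fibres≈0) ⟨
        sumFin (λ j → v j * basis j S) - sumFin (λ j → v j * basis (rep j) S)
          ≈⟨ sumFin-− (λ j → v j * basis j S) (λ j → v j * basis (rep j) S) ⟨
        sumFin (λ j → v j * basis j S - v j * basis (rep j) S)
          ≈⟨ sumFin-cong (λ j → x[y-z]≈xy-xz (v j) _ _) ⟨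
        sumFin (λ j → v j * (basis j S - basis (rep j) S)) ∎
        where
        fibres≈0 : sumFin (λ j → v j * basis (rep j) S) ≈ 0#
        fibres≈0 = begin
          sumFin (λ j → v j * basis (rep j) S)
            ≈⟨ sumFin-cong (λ j → *-comm (v j) _) ⟩
          sumFin (λ j → basis (rep j) S * v j)
            ≈⟨ sumFin-fibres rep (λ k → basis k S) v ⟩
          sumFin (λ k → basis k S * sumFin (λ j → when (does (rep j ≟ k)) (v j)))
            ≈⟨ sumFin-zero (λ k → trans (*-congˡ (rep-fibre-sum pπ k)) (zeroʳ _)) ⟩
          0# ∎

      Pπ⇒ι∈I : ∀ {v} → Pπ M v → InI M (ι v)
      Pπ⇒ι∈I {v} pπ = InI-cong (λ S → sym (ι≈basis-diffs pπ S))
        (InI-sumᴱ _ (λ j → basis-diff∈I (rep-∼ j) (v j)))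

      resonance⇒Pπ : ∀ v → Resonance M 0 1 v → Pπ M v
      resonance⇒Pπ v (x , cocycle , independent) i = *-cancel-≉0 x₀⊥≉0 (begin
        x₀ ⊥ * sumWhere (related M i) v     ≈⟨ sumWhere-*ˡ (related M i) (x₀ ⊥) v ⟨
        sumWhere (related M i) (λ j → x₀ ⊥ * v j)
                                            ≈⟨ sumWhere-cong (related M i) x₀∧v-at ⟨
        blockSum i (x₀ ∧ᴱ ι v)              ≈⟨ blockSum-kills-I i (proj₂ (cocycle zero)) ⟩
        0#                                  ∎)
        where
        x₀ = x zero
        x₀-homog : Homog 0 x₀
        x₀-homog = proj₁ (cocycle zero)
        x₀∧v-at : ∀ j → (x₀ ∧ᴱ ι v) ⁅ j ⁆ ≈ x₀ ⊥ * v j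
        x₀∧v-at j = trans (scalar-∧ᴱ x₀-homog (ι v) ⁅ j ⁆) (*-congˡ (ι-⁅⁆ v j))
        -- otherwise x₀ ≈ᴱ 0ᴱ would be a coboundary
        x₀⊥≉0 : ¬ (x₀ ⊥ ≈ 0#)
        x₀⊥≉0 x₀⊥≈0 = 0≉1 (sym (independent (λ _ → 1#) (InI-cong 0≈1·x₀ InI-0ᴱ) zero))
          where
          0≈1·x₀ : 0ᴱ ≈ᴱ sumᴱ (λ j → 1# ·ᴱ x j)
          0≈1·x₀ S = sym (trans (+-identityʳ _) (trans (*-identityˡ _) (homog0-≈0ᴱ x₀-homog x₀⊥≈0 S)))

      Pπ⇒resonance : ∀ v → Pπ M v → Resonance M 0 1 v
      Pπ⇒resonance v pπ = (λ _ → 1ᴱ) , (λ _ → 1ᴱ-homog , 1∧v∈I) , independent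
        where
        1∧v∈I : InI M (1ᴱ ∧ᴱ ι v)
        1∧v∈I = InI-cong (λ S → sym (1ᴱ-∧ᴱ (ι v) S)) (Pπ⇒ι∈I pπ)
        independent : ∀ γ → InI M (sumᴱ (λ j → γ j ·ᴱ 1ᴱ)) → ∀ j → γ j ≈ 0#
        independent γ γ1∈I zero = begin
          γ zero                  ≈⟨ *-identityʳ _ ⟨
          γ zero * 1#             ≈⟨ *-congˡ (1ᴱ-⊥ {n}) ⟨
          γ zero * 1ᴱ {n} ⊥       ≈⟨ +-identityʳ _ ⟨
          γ zero * 1ᴱ {n} ⊥ + 0#  ≈⟨ InI-at-⊥ γ1∈I ⟩
          0#                      ∎

proposition3p9 : ∀ {c ℓ} (K : Field c ℓ) (n : ℕ) (M : Matroid n) → Loopless M →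
    ∀ (v : OverField.Vect K n) →
    (OverField.Resonance K M 0 1 v → OverField.Pπ K M v) ×
    (OverField.Pπ K M v → OverField.Resonance K M 0 1 v)
proposition3p9 K n M loopless v = resonance⇒Pπ K M loopless v , Pπ⇒resonance K M loopless v
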